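{- For every integer $n\ge0$, the number of walks of length $n$ with steps in $\{ -2,-1,+1,+2\}$ starting at altitude $0$, ending at altitude $2$ and having altitude strictly greater than $0$ at every point after the start equals $$\frac{1}{2n+1}\sum_{k=0}^{n+1}(-1)^{n+k+1}\binom{2n+1}{n+k}\binom{n+2k-1}{k}.$$
   Context: A walk moves one unit right and $s$ units vertically for each step $s$. For an integer $a$ and integer $b\ge0$, $\binom{a}{b}=a(a-1)\cdots(a-b+1)/b!$ (so $\binom{ -1}{0}=1$), and $\binom{a}{b}=0$ for $b<0$. -}

module Defs where

open import Data.Nat as ℕ using (ℕ; zero; suc)
open import Data.Integer as ℤ using (ℤ; +_; -_; _+_; _*_; _-_; _<_)
open import Data.Integer.DivMod using (_/_)
open import Data.Integer.Properties using (_<?_)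
open import Data.Vec using (Vec; []; _∷_)
open import Data.List using (List; []; _∷_; map; concatMap; length; filter; upTo; foldr)
open import Data.Nat using (_!)
open import Data.Nat.Properties using (_!≢0)
open import Data.Product using (_×_; _,_)
open import Data.Unit using (⊤)
open import Relation.Binary.PropositionalEquality using (_≡_)
open import Relation.Nullary using (Dec; yes; no)
open import Relation.Nullary.Decidable using (_×-dec_)
open import Data.Integer using (_≟_)

data Step : Set where
  m2 m1 p1 p2 : Step

val : Step → ℤ
val m2 = - (+ 2)
val m1 = - (+ 1)
val p1 = + 1
val p2 = + 2

allSteps : List Step
allSteps = m2 ∷ m1 ∷ p1 ∷ p2 ∷ []

allWalks : (n : ℕ) → List (Vec Step n)
allWalks zero = [] ∷ []
allWalks (suc n) = concatMap (λ s → map (s ∷_) (allWalks n)) allSteps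

GoodFrom : {n : ℕ} → ℤ → Vec Step n → Set
GoodFrom h [] = h ≡ + 2
GoodFrom h (s ∷ w) = (+ 0 < h + val s) × GoodFrom (h + val s) w

goodFrom? : {n : ℕ} → (h : ℤ) → (w : Vec Step n) → Dec (GoodFrom h w)
goodFrom? h [] = h ≟ + 2
goodFrom? h (s ∷ w) = (+ 0 <? h + val s) ×-dec goodFrom? (h + val s) w

Good : {n : ℕ} → Vec Step n → Set
Good w = GoodFrom (+ 0) w

numWalks : ℕ → ℕ
numWalks n = length (filter (goodFrom? (+ 0)) (allWalks n))

fallingℤ : ℤ → ℕ → ℤ
fallingℤ a zero = + 1
fallingℤ a (suc b) = fallingℤ a b * (a - + b)

binomℤ : ℤ → ℕ → ℤ
binomℤ a b = fallingℤ a b / (+ (b !))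
  where instance
    _ = b !≢0

sumℤ : List ℤ → ℤ
sumℤ = foldr _+_ (+ 0)

sign : ℕ → ℤ
sign m with m ℕ.% 2
... | zero = + 1
... | suc _ = - (+ 1)

rhsSum : ℕ → ℤ
rhsSum n = sumℤ (map term (upTo (suc (suc n))))
  where
  term : ℕ → ℤ
  term k = sign (n ℕ.+ k ℕ.+ 1) * binomℤ (+ (2 ℕ.* n ℕ.+ 1)) (n ℕ.+ k)
             * binomℤ (+ (n ℕ.+ 2 ℕ.* k) - + 1) k

-- Let ψ = 1/(1 - x) - x, Λ = ψ², and let u(t) be the power series with u = t Λ(u).
-- For each altitude h ≥ 1 there is an explicit rational series F_h (walkSeries h) with
-- Λ F_h = [h = 2] Λ + x Σ_s F_{h+s}, the sum over the steps s with h + s > 0.  At x = u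
-- this reads F_h(u) = [h = 2] + t Σ_s F_{h+s}(u), the first-step recursion of the walk
-- counts, so F_h(u) is their generating function.  The series G = x²/(1 - x + x²)
-- equals 1 - 1/ψ and satisfies Λ² G = x² (F₁ + F₂), so G(u) = Σ_n W_n t^(n+1) for the
-- walks W_n of the theorem.  The derivative form of Lagrange inversion then gives
-- (2n+1) W_n = [x^(n+1)] ψ^(2n+1), and the binomial theorem applied to ψ = 1/(1-x) - x
-- expands the right-hand side into the stated sum.

module Submission where

open import Defs
open import Data.Nat using (ℕ; _+_; _*_)
open import Data.Integer using (+_) renaming (_*_ to _*ℤ_)
open import Relation.Binary.PropositionalEquality using (_≡_)

open import Data.Nat using (zero; suc; _∸_; _<_; _≤_; z≤n; s≤s; _!)
import Data.Nat as ℕ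
open import Data.Nat.Combinatorics using (_C_; nCk≡nPk/k!; nCk+nC[k+1]≡[n+1]C[k+1]; nCn≡1)
open import Data.Nat.Combinatorics.Base using (_P_; _P′_)
open import Data.Nat.Combinatorics.Specification using (k>n⇒nCk≡0)
open import Data.Nat.DivMod using (_/_; 0/n≡0)
import Data.Nat.Properties as ℕₚ
open import Data.Integer using (ℤ; -_; _≟_; _/ℕ_) renaming (_+_ to _+ℤ_)
import Data.Integer.Properties as ℤₚ
open import Data.Integer.Properties using (_<?_)
open import Data.Bool using (true; false; if_then_else_)
open import Data.List using (List; []; _∷_; map; length; filter; _++_; applyUpTo)
open import Data.List.Properties using (filter-++; length-++)
open import Data.Maybe using (Maybe; just; nothing)
open import Data.Vec using (Vec; []; _∷_)
open import Data.Product using (_×_; _,_; proj₁)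
open import Data.Fin using (toℕ)
open import Data.Sum using (_⊎_; inj₁; inj₂)
open import Function using (_∘_)
open import Relation.Binary.PropositionalEquality
  using (_≗_; refl; sym; trans; cong; cong₂; subst₂; _→-setoid_; module ≡-Reasoning)
open import Relation.Binary.Bundles using (Setoid)
open import Relation.Nullary using (yes; no; does)
open import Algebra.Bundles using (Semiring; CommutativeRing)
open import Algebra.Structures {A = ℕ → ℤ} _≗_
  using (IsCommutativeSemiring; IsSemigroup)
open import Algebra.Structures.Biased {A = ℕ → ℤ} _≗_
  using (IsCommutativeSemiringˡ; isCommutativeMonoidˡ)
open import Algebra.Solver.Ring.AlmostCommutativeRing
  using (AlmostCommutativeRing; _-Raw-AlmostCommutative⟶_)
import Algebra.Solver.Ring
import Relation.Binary.Reasoning.Setoid as SetoidReasoning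
open import Data.Integer.Tactic.RingSolver using (solve-∀)
open import Data.Nat.Tactic.RingSolver using () renaming (solve-∀ to solveℕ-∀)

-- Formal power series over ℤ

Series : Set
Series = ℕ → ℤ

series-setoid : Setoid _ _
series-setoid = ℕ →-setoid ℤ

open Setoid series-setoid
  using () renaming (refl to ≗-refl; sym to ≗-sym; trans to ≗-trans; isEquivalence to ≗-isEquivalence)

infixl 6 _+ₛ_
infixl 7 _*ₛ_ _·_
infix 8 -ₛ_

0ₛ : Series
0ₛ _ = + 0

const : ℤ → Series
const c zero = c
const c (suc _) = + 0

1ₛ : Series
1ₛ = const (+ 1)

_+ₛ_ : Series → Series → Series
(F +ₛ G) n = F n +ℤ G n

-ₛ_ : Series → Series
(-ₛ F) n = - F n

_·_ : ℤ → Series → Series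
(c · F) n = c *ℤ F n

tail : Series → Series
tail F = F ∘ suc

-- The Cauchy product, recursing on the left factor through F = F 0 + X · tail F.
_*ₛ_ : Series → Series → Series
(F *ₛ G) zero = F 0 *ℤ G 0
(F *ₛ G) (suc n) = F 0 *ℤ G (suc n) +ℤ (tail F *ₛ G) n

+-cong : ∀ {F F′ G G′} → F ≗ F′ → G ≗ G′ → F +ₛ G ≗ F′ +ₛ G′
+-cong p q n = cong₂ _+ℤ_ (p n) (q n)

-‿cong : ∀ {F F′} → F ≗ F′ → -ₛ F ≗ -ₛ F′
-‿cong p n = cong -_ (p n)

*-cong : ∀ {F F′ G G′} → F ≗ F′ → G ≗ G′ → F *ₛ G ≗ F′ *ₛ G′
*-cong p q zero = cong₂ _*ℤ_ (p 0) (q 0)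
*-cong p q (suc n) = cong₂ _+ℤ_ (cong₂ _*ℤ_ (p 0) (q (suc n))) (*-cong (p ∘ suc) q n)

+-congˡ : ∀ F {G G′} → G ≗ G′ → F +ₛ G ≗ F +ₛ G′
+-congˡ F = +-cong {F} ≗-refl

+-congʳ : ∀ G {F F′} → F ≗ F′ → F +ₛ G ≗ F′ +ₛ G
+-congʳ G p = +-cong p (≗-refl {G})

*-congˡ : ∀ F {G G′} → G ≗ G′ → F *ₛ G ≗ F *ₛ G′
*-congˡ F = *-cong {F} ≗-refl

*-congʳ : ∀ G {F F′} → F ≗ F′ → F *ₛ G ≗ F′ *ₛ G
*-congʳ G p = *-cong p (≗-refl {G})

+-assoc : ∀ F G H → (F +ₛ G) +ₛ H ≗ F +ₛ (G +ₛ H)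
+-assoc F G H n = ℤₚ.+-assoc (F n) (G n) (H n)

+-comm : ∀ F G → F +ₛ G ≗ G +ₛ F
+-comm F G n = ℤₚ.+-comm (F n) (G n)

+-identityˡ : ∀ F → 0ₛ +ₛ F ≗ F
+-identityˡ F n = ℤₚ.+-identityˡ (F n)

*-zeroˡ : ∀ G → 0ₛ *ₛ G ≗ 0ₛ
*-zeroˡ G zero = ℤₚ.*-zeroˡ (G 0)
*-zeroˡ G (suc n) = cong₂ _+ℤ_ (ℤₚ.*-zeroˡ (G (suc n))) (*-zeroˡ G n)

*-identityˡ : ∀ G → 1ₛ *ₛ G ≗ G
*-identityˡ G zero = ℤₚ.*-identityˡ (G 0)
*-identityˡ G (suc n) =
  trans (cong₂ _+ℤ_ (ℤₚ.*-identityˡ (G (suc n))) (*-zeroˡ G n)) (ℤₚ.+-identityʳ (G (suc n)))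

·-*-assoc : ∀ c F G → (c · F) *ₛ G ≗ c · (F *ₛ G)
·-*-assoc c F G zero = ℤₚ.*-assoc c (F 0) (G 0)
·-*-assoc c F G (suc n) =
  trans (cong₂ _+ℤ_ (ℤₚ.*-assoc c (F 0) (G (suc n))) (·-*-assoc c (tail F) G n))
        (sym (ℤₚ.*-distribˡ-+ c (F 0 *ℤ G (suc n)) ((tail F *ₛ G) n)))

*-distribʳ-+ : ∀ H F G → (F +ₛ G) *ₛ H ≗ F *ₛ H +ₛ G *ₛ H
*-distribʳ-+ H F G zero = ℤₚ.*-distribʳ-+ (H 0) (F 0) (G 0)
*-distribʳ-+ H F G (suc n) =
  trans (cong₂ _+ℤ_ (ℤₚ.*-distribʳ-+ (H (suc n)) (F 0) (G 0)) (*-distribʳ-+ H (tail F) (tail G) n))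
        (interchange (F 0 *ℤ H (suc n)) (G 0 *ℤ H (suc n)) ((tail F *ₛ H) n) ((tail G *ₛ H) n))
  where
  interchange : ∀ a b c d → a +ℤ b +ℤ (c +ℤ d) ≡ a +ℤ c +ℤ (b +ℤ d)
  interchange = solve-∀

-‿*-distribˡ : ∀ F G → (-ₛ F) *ₛ G ≗ -ₛ (F *ₛ G)
-‿*-distribˡ F G zero = sym (ℤₚ.neg-distribˡ-* (F 0) (G 0))
-‿*-distribˡ F G (suc n) =
  trans (cong₂ _+ℤ_ (sym (ℤₚ.neg-distribˡ-* (F 0) (G (suc n)))) (-‿*-distribˡ (tail F) G n))
        (sym (ℤₚ.neg-distrib-+ (F 0 *ℤ G (suc n)) ((tail F *ₛ G) n)))

*-suc : ∀ F G n → (F *ₛ G) (suc n) ≡ (F *ₛ tail G) n +ℤ F (suc n) *ℤ G 0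
*-suc F G zero = refl
*-suc F G (suc n) =
  trans (cong (F 0 *ℤ G (suc (suc n)) +ℤ_) (*-suc (tail F) G n))
        (sym (ℤₚ.+-assoc (F 0 *ℤ G (suc (suc n))) ((tail F *ₛ tail G) n) (F (suc (suc n)) *ℤ G 0)))

*-comm : ∀ F G → F *ₛ G ≗ G *ₛ F
*-comm F G zero = ℤₚ.*-comm (F 0) (G 0)
*-comm F G (suc n) =
  trans (cong₂ _+ℤ_ (ℤₚ.*-comm (F 0) (G (suc n))) (*-comm (tail F) G n))
  (trans (ℤₚ.+-comm (G (suc n) *ℤ F 0) ((G *ₛ tail F) n)) (sym (*-suc G F n)))

*-assoc : ∀ F G H → (F *ₛ G) *ₛ H ≗ F *ₛ (G *ₛ H)
*-assoc F G H zero = ℤₚ.*-assoc (F 0) (G 0) (H 0)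
*-assoc F G H (suc n) =
  begin
    (F 0 *ℤ G 0) *ℤ H (suc n) +ℤ ((F 0 · tail G +ₛ tail F *ₛ G) *ₛ H) n
  ≡⟨ cong ((F 0 *ℤ G 0) *ℤ H (suc n) +ℤ_)
       (trans (*-distribʳ-+ H (F 0 · tail G) (tail F *ₛ G) n)
              (cong₂ _+ℤ_ (·-*-assoc (F 0) (tail G) H n) (*-assoc (tail F) G H n))) ⟩
    (F 0 *ℤ G 0) *ℤ H (suc n) +ℤ (F 0 *ℤ (tail G *ₛ H) n +ℤ (tail F *ₛ (G *ₛ H)) n)
  ≡⟨ regroup (F 0) (G 0) (H (suc n)) ((tail G *ₛ H) n) ((tail F *ₛ (G *ₛ H)) n) ⟩
    F 0 *ℤ (G 0 *ℤ H (suc n) +ℤ (tail G *ₛ H) n) +ℤ (tail F *ₛ (G *ₛ H)) n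
  ∎
  where
  open ≡-Reasoning
  regroup : ∀ a b c d e → (a *ℤ b) *ℤ c +ℤ (a *ℤ d +ℤ e) ≡ a *ℤ (b *ℤ c +ℤ d) +ℤ e
  regroup = solve-∀

*-identityʳ : ∀ F → F *ₛ 1ₛ ≗ F
*-identityʳ F = ≗-trans (*-comm F 1ₛ) (*-identityˡ F)

*-·-comm : ∀ c F G → F *ₛ (c · G) ≗ c · (F *ₛ G)
*-·-comm c F G =
  ≗-trans (*-comm F (c · G)) (≗-trans (·-*-assoc c G F) (λ n → cong (c *ℤ_) (*-comm G F n)))

isCommutativeSemiring : IsCommutativeSemiring _+ₛ_ _*ₛ_ 0ₛ 1ₛ
isCommutativeSemiring = IsCommutativeSemiringˡ.isCommutativeSemiring record
  { +-isCommutativeMonoid = isCommutativeMonoidˡ record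
    { isSemigroup = semigroup +-cong +-assoc ; identityˡ = +-identityˡ ; comm = +-comm }
  ; *-isCommutativeMonoid = isCommutativeMonoidˡ record
    { isSemigroup = semigroup *-cong *-assoc ; identityˡ = *-identityˡ ; comm = *-comm }
  ; distribʳ = *-distribʳ-+
  ; zeroˡ = *-zeroˡ
  }
  where
  semigroup : ∀ {_∙_} → (∀ {F F′ G G′} → F ≗ F′ → G ≗ G′ → (F ∙ G) ≗ (F′ ∙ G′)) →
              (∀ F G H → ((F ∙ G) ∙ H) ≗ (F ∙ (G ∙ H))) → IsSemigroup _∙_
  semigroup ∙-cong ∙-assoc = record
    { isMagma = record { isEquivalence = ≗-isEquivalence ; ∙-cong = ∙-cong } ; assoc = ∙-assoc }

seriesRing : AlmostCommutativeRing _ _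
seriesRing = record
  { isAlmostCommutativeRing = record
    { isCommutativeSemiring = isCommutativeSemiring
    ; -‿cong = -‿cong
    ; -‿*-distribˡ = -‿*-distribˡ
    ; -‿+-comm = λ F G n → sym (ℤₚ.neg-distrib-+ (F n) (G n))
    }
  }

seriesSemiring : Semiring _ _
seriesSemiring = AlmostCommutativeRing.semiring seriesRing

open import Algebra.Properties.Semiring.Exp seriesSemiring
  using (^-homo-*) renaming (_^_ to _^ₛ_)
open import Algebra.Properties.Semiring.Sum seriesSemiring using (sum)
open import Algebra.Properties.Semiring.Mult seriesSemiring using () renaming (_×_ to _×ₛ_)
open import Algebra.Properties.CommutativeSemiring.Exp (AlmostCommutativeRing.commutativeSemiring seriesRing)
  using (^-distrib-*)

const-homomorphism : CommutativeRing.rawRing ℤₚ.+-*-commutativeRing -Raw-AlmostCommutative⟶ seriesRing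
const-homomorphism = record
  { ⟦_⟧ = const
  ; +-homo = λ { a b zero → refl ; a b (suc n) → refl }
  ; *-homo = λ { a b zero → refl
               ; a b (suc n) → sym (trans (cong (a *ℤ + 0 +ℤ_) (*-zeroˡ (const b) n))
                                          (cong (_+ℤ + 0) (ℤₚ.*-zeroʳ a))) }
  ; -‿homo = λ { a zero → refl ; a (suc n) → refl }
  ; 0-homo = λ { zero → refl ; (suc n) → refl }
  ; 1-homo = λ _ → refl
  }

const-≟ : ∀ a b → Maybe (const a ≗ const b)
const-≟ a b with a ≟ b
... | yes refl = just ≗-refl
... | no _ = nothing

module SeriesSolver = Algebra.Solver.Ring _ seriesRing const-homomorphism const-≟
open SeriesSolver using (solve; _:=_; _:+_; _:*_; :-_; _:^_; con; Polynomial)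

X : Series
X zero = + 0
X (suc zero) = + 1
X (suc (suc _)) = + 0

shift : Series → Series
shift F zero = + 0
shift F (suc n) = F n

X*≗shift : ∀ F → X *ₛ F ≗ shift F
X*≗shift F zero = refl
X*≗shift F (suc n) = trans (ℤₚ.+-identityˡ _) (trans (*-congʳ F tail-X n) (*-identityˡ F n))
  where
  tail-X : tail X ≗ 1ₛ
  tail-X zero = refl
  tail-X (suc _) = refl

geometric : Series
geometric _ = + 1

geometric-unfold : geometric ≗ 1ₛ +ₛ X *ₛ geometric
geometric-unfold zero = refl
geometric-unfold (suc n) = sym (trans (ℤₚ.+-identityˡ _) (X*≗shift geometric (suc n)))

∂ : Series → Series
∂ F n = + suc n *ℤ F (suc n)

∂-cong : ∀ {F G} → F ≗ G → ∂ F ≗ ∂ G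
∂-cong p n = cong (+ suc n *ℤ_) (p (suc n))

tail-∂ : ∀ F → tail (∂ F) ≗ ∂ (tail F) +ₛ tail (tail F)
tail-∂ F n = split (+ suc n) (F (suc (suc n)))
  where
  split : ∀ N a → (+ 1 +ℤ N) *ℤ a ≡ N *ℤ a +ℤ a
  split = solve-∀

∂-* : ∀ F G → ∂ (F *ₛ G) ≗ ∂ F *ₛ G +ₛ F *ₛ ∂ G
∂-* F G zero = regroup (F 0) (G 1) (F 1) (G 0)
  where
  regroup : ∀ a b c d → + 1 *ℤ (a *ℤ b +ℤ c *ℤ d) ≡ (+ 1 *ℤ c) *ℤ d +ℤ a *ℤ (+ 1 *ℤ b)
  regroup = solve-∀
∂-* F G (suc n) =
  begin
    (+ 1 +ℤ N) *ℤ (F 0 *ℤ G (suc (suc n)) +ℤ (tail F *ₛ G) (suc n))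
  ≡⟨ expand (F 0) (G (suc (suc n))) ((tail F *ₛ G) (suc n)) N ⟩
    F 0 *ℤ ∂ G (suc n) +ℤ ((tail F *ₛ G) (suc n) +ℤ N *ℤ (tail F *ₛ G) (suc n))
  ≡⟨ cong (λ z → F 0 *ℤ ∂ G (suc n) +ℤ ((tail F *ₛ G) (suc n) +ℤ z)) (∂-* (tail F) G n) ⟩
    F 0 *ℤ ∂ G (suc n) +ℤ ((tail F *ₛ G) (suc n) +ℤ ((∂ (tail F) *ₛ G) n +ℤ (tail F *ₛ ∂ G) n))
  ≡⟨ regroup (F 0 *ℤ ∂ G (suc n)) (F 1) (G (suc n))
              ((tail (tail F) *ₛ G) n) ((∂ (tail F) *ₛ G) n) ((tail F *ₛ ∂ G) n) ⟩
    (+ 1 *ℤ F 1) *ℤ G (suc n) +ℤ ((∂ (tail F) *ₛ G) n +ℤ (tail (tail F) *ₛ G) n)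
      +ℤ (F 0 *ℤ ∂ G (suc n) +ℤ (tail F *ₛ ∂ G) n)
  ≡⟨ cong (λ z → (+ 1 *ℤ F 1) *ℤ G (suc n) +ℤ z +ℤ (F 0 *ℤ ∂ G (suc n) +ℤ (tail F *ₛ ∂ G) n))
       (sym (trans (*-cong (tail-∂ F) ≗-refl n) (*-distribʳ-+ G (∂ (tail F)) (tail (tail F)) n))) ⟩
    (∂ F *ₛ G) (suc n) +ℤ (F *ₛ ∂ G) (suc n)
  ∎
  where
  open ≡-Reasoning
  N = + suc n
  expand : ∀ a b c N → (+ 1 +ℤ N) *ℤ (a *ℤ b +ℤ c) ≡ a *ℤ ((+ 1 +ℤ N) *ℤ b) +ℤ (c +ℤ N *ℤ c)
  expand = solve-∀
  regroup : ∀ a f g t d e → a +ℤ (f *ℤ g +ℤ t +ℤ (d +ℤ e)) ≡ (+ 1 *ℤ f) *ℤ g +ℤ (d +ℤ t) +ℤ (a +ℤ e)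
  regroup = solve-∀

∂-^ : ∀ F k → ∂ (F ^ₛ suc k) ≗ + suc k · (F ^ₛ k *ₛ ∂ F)
∂-^ F zero n = trans (∂-cong (*-identityʳ F) n) (sym (trans (ℤₚ.*-identityˡ _) (*-identityˡ (∂ F) n)))
∂-^ F (suc k) =
  begin
    ∂ (F *ₛ F ^ₛ suc k)
  ≈⟨ ∂-* F (F ^ₛ suc k) ⟩
    ∂ F *ₛ F ^ₛ suc k +ₛ F *ₛ ∂ (F ^ₛ suc k)
  ≈⟨ +-cong (*-comm (∂ F) (F ^ₛ suc k)) (*-congˡ F (∂-^ F k)) ⟩
    F ^ₛ suc k *ₛ ∂ F +ₛ F *ₛ (+ suc k · (F ^ₛ k *ₛ ∂ F))
  ≈⟨ +-congˡ (F ^ₛ suc k *ₛ ∂ F) (≗-trans (*-·-comm (+ suc k) F (F ^ₛ k *ₛ ∂ F))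
                                           (λ n → cong (+ suc k *ℤ_) (sym (*-assoc F (F ^ₛ k) (∂ F) n)))) ⟩
    F ^ₛ suc k *ₛ ∂ F +ₛ + suc k · (F ^ₛ suc k *ₛ ∂ F)
  ≈⟨ (λ n → sym (ℤₚ.suc-* (+ suc k) ((F ^ₛ suc k *ₛ ∂ F) n))) ⟩
    + suc (suc k) · (F ^ₛ suc k *ₛ ∂ F)
  ∎
  where open SetoidReasoning series-setoid

-- Lagrange inversion

module Lagrange (Λ : Series) (Λ₀≡1 : Λ 0 ≡ + 1) where

  Δ : Series
  Δ = Λ +ₛ -ₛ (X *ₛ ∂ Λ)

  -- rootCoeff m F is [tᵐ] F(u) for the series u = t Λ(u): the Lagrange–Bürmann
  -- formula is taken as the definition, so no series is ever composed.
  rootCoeff : ℕ → Series → ℤ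
  rootCoeff zero F = F 0
  rootCoeff (suc m) F = (F *ₛ (Λ ^ₛ m *ₛ Δ)) (suc m)

  rootCoeff-cong : ∀ m {F G} → F ≗ G → rootCoeff m F ≡ rootCoeff m G
  rootCoeff-cong zero p = p 0
  rootCoeff-cong (suc m) p = *-cong p ≗-refl (suc m)

  rootCoeff-+ : ∀ m F G → rootCoeff m (F +ₛ G) ≡ rootCoeff m F +ℤ rootCoeff m G
  rootCoeff-+ zero F G = refl
  rootCoeff-+ (suc m) F G = *-distribʳ-+ (Λ ^ₛ m *ₛ Δ) F G (suc m)

  rootCoeff-∂ : ∀ m F → + suc m *ℤ rootCoeff (suc m) F ≡ (∂ F *ₛ Λ ^ₛ suc m) m
  rootCoeff-∂ m F =
    begin
      N *ℤ rootCoeff (suc m) F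
    ≡⟨ cong (N *ℤ_) (split (suc m)) ⟩
      N *ℤ (A (suc m) +ℤ - (X *ₛ B) (suc m))
    ≡⟨ cong (λ z → N *ℤ (A (suc m) +ℤ - z)) (X*≗shift B (suc m)) ⟩
      N *ℤ (A (suc m) +ℤ - B m)
    ≡⟨ distrib N (A (suc m)) (B m) ⟩
      ∂ A m +ℤ - (N *ℤ B m)
    ≡⟨ cong (_+ℤ - (N *ℤ B m)) (∂-* F (Λ ^ₛ suc m) m) ⟩
      (∂ F *ₛ Λ ^ₛ suc m) m +ℤ (F *ₛ ∂ (Λ ^ₛ suc m)) m +ℤ - (N *ℤ B m)
    ≡⟨ cong (λ z → (∂ F *ₛ Λ ^ₛ suc m) m +ℤ z +ℤ - (N *ℤ B m)) ∂-power ⟩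
      (∂ F *ₛ Λ ^ₛ suc m) m +ℤ N *ℤ B m +ℤ - (N *ℤ B m)
    ≡⟨ cancel ((∂ F *ₛ Λ ^ₛ suc m) m) (N *ℤ B m) ⟩
      (∂ F *ₛ Λ ^ₛ suc m) m
    ∎
    where
    open ≡-Reasoning
    N = + suc m
    A = F *ₛ Λ ^ₛ suc m
    B = F *ₛ Λ ^ₛ m *ₛ ∂ Λ
    split : F *ₛ (Λ ^ₛ m *ₛ Δ) ≗ A +ₛ -ₛ (X *ₛ B)
    split = solve 5 (λ f l lm x d → f :* (lm :* (l :+ :- (x :* d))) := f :* (l :* lm) :+ :- (x :* (f :* lm :* d)))
                    ≗-refl F Λ (Λ ^ₛ m) X (∂ Λ)
    ∂-power : (F *ₛ ∂ (Λ ^ₛ suc m)) m ≡ N *ℤ B m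
    ∂-power = trans (*-cong ≗-refl (∂-^ Λ m) m)
                    (trans (*-·-comm N F _ m) (cong (N *ℤ_) (sym (*-assoc F (Λ ^ₛ m) (∂ Λ) m))))
    distrib : ∀ N a b → N *ℤ (a +ℤ - b) ≡ N *ℤ a +ℤ - (N *ℤ b)
    distrib = solve-∀
    cancel : ∀ a b → a +ℤ b +ℤ - b ≡ a
    cancel = solve-∀

  rootCoeff-suc-1ₛ : ∀ m → rootCoeff (suc m) 1ₛ ≡ + 0
  rootCoeff-suc-1ₛ m = ℤₚ.*-cancelˡ-≡ (+ suc m) _ _
    (trans (rootCoeff-∂ m 1ₛ)
      (trans (*-cong ∂-1ₛ ≗-refl m) (trans (*-zeroˡ (Λ ^ₛ suc m) m) (sym (ℤₚ.*-zeroʳ (+ suc m))))))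
    where
    ∂-1ₛ : ∂ 1ₛ ≗ 0ₛ
    ∂-1ₛ n = ℤₚ.*-zeroʳ (+ suc n)

  rootCoeff-one : ∀ F → rootCoeff 1 F ≡ F 1
  rootCoeff-one F =
    begin
      F 0 *ℤ (1ₛ *ₛ Δ) 1 +ℤ F 1 *ℤ (1ₛ *ₛ Δ) 0
    ≡⟨ cong₂ (λ a b → F 0 *ℤ a +ℤ F 1 *ℤ b)
         (trans (*-identityˡ Δ 1) (cong (λ z → Λ 1 +ℤ - z) (X*≗shift (∂ Λ) 1)))
         (trans (*-identityˡ Δ 0) (trans (ℤₚ.+-identityʳ (Λ 0)) Λ₀≡1)) ⟩
      F 0 *ℤ (Λ 1 +ℤ - (+ 1 *ℤ Λ 1)) +ℤ F 1 *ℤ + 1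
    ≡⟨ simplify (F 0) (F 1) (Λ 1) ⟩
      F 1
    ∎
    where
    open ≡-Reasoning
    simplify : ∀ a b c → a *ℤ (c +ℤ - (+ 1 *ℤ c)) +ℤ b *ℤ + 1 ≡ b
    simplify = solve-∀

  -- The coefficient form of: Λ(u) F(u) = c Λ(u) + u S(u) implies F(u) = c + t S(u).
  rootCoeff-step : ∀ c F S → Λ *ₛ F ≗ c · Λ +ₛ X *ₛ S → ∀ m → rootCoeff (suc m) F ≡ rootCoeff m S
  rootCoeff-step c F S h zero =
    begin
      rootCoeff 1 F
    ≡⟨ rootCoeff-one F ⟩
      F 1
    ≡⟨ isolate (F 1) (Λ 1) c ⟩
      (+ 1 *ℤ F 1 +ℤ Λ 1 *ℤ c) +ℤ - (c *ℤ Λ 1)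
    ≡⟨ cong (λ z → z +ℤ - (c *ℤ Λ 1)) (trans (sym (cong₂ (λ a b → a *ℤ F 1 +ℤ Λ 1 *ℤ b) Λ₀≡1 F₀≡c))
                                                 (trans (h 1) (cong (c *ℤ Λ 1 +ℤ_) (X*≗shift S 1)))) ⟩
      (c *ℤ Λ 1 +ℤ S 0) +ℤ - (c *ℤ Λ 1)
    ≡⟨ isolate′ (c *ℤ Λ 1) (S 0) ⟩
      S 0
    ∎
    where
    open ≡-Reasoning
    F₀≡c : F 0 ≡ c
    F₀≡c = begin
      F 0                  ≡⟨ sym (ℤₚ.*-identityˡ (F 0)) ⟩
      + 1 *ℤ F 0           ≡⟨ cong (_*ℤ F 0) (sym Λ₀≡1) ⟩
      Λ 0 *ℤ F 0           ≡⟨ h 0 ⟩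
      c *ℤ Λ 0 +ℤ + 0      ≡⟨ trans (ℤₚ.+-identityʳ _) (cong (c *ℤ_) Λ₀≡1) ⟩
      c *ℤ + 1             ≡⟨ ℤₚ.*-identityʳ c ⟩
      c                    ∎
    isolate : ∀ f l c → f ≡ (+ 1 *ℤ f +ℤ l *ℤ c) +ℤ - (c *ℤ l)
    isolate = solve-∀
    isolate′ : ∀ a s → (a +ℤ s) +ℤ - a ≡ s
    isolate′ = solve-∀
  rootCoeff-step c F S h (suc m) =
    begin
      (F *ₛ (Λ ^ₛ suc m *ₛ Δ)) (suc (suc m))
    ≡⟨ reassociate (suc (suc m)) ⟩
      ((Λ *ₛ F) *ₛ W) (suc (suc m))
    ≡⟨ *-cong h ≗-refl (suc (suc m)) ⟩
      ((c · Λ +ₛ X *ₛ S) *ₛ W) (suc (suc m))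
    ≡⟨ *-distribʳ-+ W (c · Λ) (X *ₛ S) (suc (suc m)) ⟩
      ((c · Λ) *ₛ W) (suc (suc m)) +ℤ ((X *ₛ S) *ₛ W) (suc (suc m))
    ≡⟨ cong₂ _+ℤ_ (trans (·-*-assoc c Λ W (suc (suc m))) (cong (c *ℤ_) vanishing))
                  (trans (*-assoc X S W (suc (suc m))) (X*≗shift (S *ₛ W) (suc (suc m)))) ⟩
      c *ℤ + 0 +ℤ (S *ₛ W) (suc m)
    ≡⟨ trans (cong (_+ℤ (S *ₛ W) (suc m)) (ℤₚ.*-zeroʳ c)) (ℤₚ.+-identityˡ _) ⟩
      rootCoeff (suc m) S
    ∎
    where
    open ≡-Reasoning
    W = Λ ^ₛ m *ₛ Δ
    reassociate : F *ₛ (Λ ^ₛ suc m *ₛ Δ) ≗ (Λ *ₛ F) *ₛ W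
    reassociate = solve 4 (λ f l lm d → f :* ((l :* lm) :* d) := (l :* f) :* (lm :* d)) ≗-refl F Λ (Λ ^ₛ m) Δ
    vanishing : (Λ *ₛ W) (suc (suc m)) ≡ + 0
    vanishing = trans (sym (*-assoc Λ (Λ ^ₛ m) Δ (suc (suc m))))
                      (trans (sym (*-identityˡ (Λ ^ₛ suc m *ₛ Δ) (suc (suc m)))) (rootCoeff-suc-1ₛ (suc m)))

  rootCoeff-step₀ : ∀ F S → Λ *ₛ F ≗ X *ₛ S → ∀ m → rootCoeff (suc m) F ≡ rootCoeff m S
  rootCoeff-step₀ F S h = rootCoeff-step (+ 0) F S (λ n → trans (h n) (sym (ℤₚ.+-identityˡ _)))

-- Counting walks

walksFrom : ℕ → ℤ → ℕ
walksFrom n h = length (filter (goodFrom? h) (allWalks n))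

walksWithFirstStep : ℕ → ℤ → Step → ℕ
walksWithFirstStep n h s = if does (+ 0 <? h +ℤ val s) then walksFrom n (h +ℤ val s) else 0

length-filter-goodFrom-∷ : ∀ {n} h s (ws : List (Vec Step n)) →
  length (filter (goodFrom? h) (map (s ∷_) ws)) ≡
  (if does (+ 0 <? h +ℤ val s) then length (filter (goodFrom? (h +ℤ val s)) ws) else 0)
length-filter-goodFrom-∷ h s [] with does (+ 0 <? h +ℤ val s)
... | true = refl
... | false = refl
length-filter-goodFrom-∷ h s (w ∷ ws) with does (+ 0 <? h +ℤ val s) | length-filter-goodFrom-∷ h s ws
... | false | ih = ih
... | true | ih with does (goodFrom? (h +ℤ val s) w)
...   | false = ih
...   | true = cong suc ih

walksFrom-suc : ∀ n h → walksFrom (suc n) h ≡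
  walksWithFirstStep n h m2 + (walksWithFirstStep n h m1 + (walksWithFirstStep n h p1 + (walksWithFirstStep n h p2 + 0)))
walksFrom-suc n h =
  trans (firstStep m2) (cong (_+_ (w m2)) (trans (firstStep m1) (cong (_+_ (w m1))
    (trans (firstStep p1) (cong (_+_ (w p1)) (firstStep p2))))))
  where
  w = walksWithFirstStep n h
  firstStep : ∀ s {rest} → length (filter (goodFrom? h) (map (s ∷_) (allWalks n) ++ rest)) ≡
                           walksWithFirstStep n h s + length (filter (goodFrom? h) rest)
  firstStep s {rest} =
    trans (cong length (filter-++ (goodFrom? h) (map (s ∷_) (allWalks n)) rest))
          (trans (length-++ (filter (goodFrom? h) (map (s ∷_) (allWalks n))))
                 (cong (_+ length (filter (goodFrom? h) rest)) (length-filter-goodFrom-∷ h s (allWalks n))))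

-- The series of walks from each altitude

ψ : Series
ψ = geometric +ₛ -ₛ X

Λ : Series
Λ = ψ *ₛ ψ

open Lagrange Λ refl

U : Series
U = 1ₛ +ₛ -ₛ X

Q : Series
Q = U +ₛ X *ₛ X

-- The numerators are an ansatz, justified only by the kernel relations walkKernel₁,
-- walkKernel₂ and walkKernel₃₊ below.
walkNumerator : ℕ → Series
walkNumerator 0 = 0ₛ
walkNumerator 1 = X *ₛ (Q *ₛ Q)
walkNumerator 2 = (Q *ₛ Q) *ₛ (Q +ₛ -ₛ (X *ₛ U))
walkNumerator (suc (suc (suc h))) =
  X *ₛ walkNumerator (suc (suc h)) +ₛ X *ₛ (U *ₛ U) *ₛ walkNumerator (suc h)

walkSeries : ℕ → Series
walkSeries h = geometric ^ₛ (2 + h) *ₛ walkNumerator h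

-- Syntactic copies of U, Q and walkNumerator for the ring solver.
module _ {k : ℕ} where
  Uₑ Qₑ : Polynomial k → Polynomial k
  Uₑ x = con (+ 1) :+ :- x
  Qₑ x = Uₑ x :+ x :* x

  walkNumeratorₑ : ℕ → Polynomial k → Polynomial k
  walkNumeratorₑ 0 x = con (+ 0)
  walkNumeratorₑ 1 x = x :* (Qₑ x :* Qₑ x)
  walkNumeratorₑ 2 x = (Qₑ x :* Qₑ x) :* (Qₑ x :+ :- (x :* Uₑ x))
  walkNumeratorₑ (suc (suc (suc h))) x =
    x :* walkNumeratorₑ (suc (suc h)) x :+ x :* (Uₑ x :* Uₑ x) :* walkNumeratorₑ (suc h) x

numeratorKernel₁ : Q *ₛ Q *ₛ walkNumerator 1 ≗ X *ₛ (U *ₛ walkNumerator 2 +ₛ walkNumerator 3)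
numeratorKernel₁ = solve 1 (λ x → Qₑ x :* Qₑ x :* P 1 x := x :* (Uₑ x :* P 2 x :+ P 3 x)) ≗-refl X
  where P = walkNumeratorₑ

numeratorKernel₂ : Q *ₛ Q *ₛ walkNumerator 2 ≗
  Q *ₛ Q *ₛ U ^ₛ 4 +ₛ X *ₛ (U ^ₛ 3 *ₛ walkNumerator 1 +ₛ U *ₛ walkNumerator 3 +ₛ walkNumerator 4)
numeratorKernel₂ = solve 1 (λ x → Qₑ x :* Qₑ x :* P 2 x
                               := Qₑ x :* Qₑ x :* Uₑ x :^ 4 :+ x :* (Uₑ x :^ 3 :* P 1 x :+ Uₑ x :* P 3 x :+ P 4 x))
                         ≗-refl X
  where P = walkNumeratorₑ

NumeratorKernel₃₊ : ℕ → Set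
NumeratorKernel₃₊ j =
  Q *ₛ Q *ₛ walkNumerator (3 + j) ≗
  X *ₛ (U ^ₛ 4 *ₛ walkNumerator (1 + j) +ₛ U ^ₛ 3 *ₛ walkNumerator (2 + j)
        +ₛ U *ₛ walkNumerator (4 + j) +ₛ walkNumerator (5 + j))

-- The numerators satisfy a linear recurrence, so two instances of the kernel
-- relation propagate to all.
numeratorKernel₃₊ : ∀ j → NumeratorKernel₃₊ j
numeratorKernel₃₊ j = proj₁ (consecutive j)
  where
  equationₑ : ℕ → Polynomial 1 → Polynomial 1 × Polynomial 1
  equationₑ j x =
    Qₑ x :* Qₑ x :* P (3 + j)
      := x :* (Uₑ x :^ 4 :* P (1 + j) :+ Uₑ x :^ 3 :* P (2 + j) :+ Uₑ x :* P (4 + j) :+ P (5 + j))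
    where P = λ h → walkNumeratorₑ h x
  step : ∀ j → NumeratorKernel₃₊ j → NumeratorKernel₃₊ (suc j) → NumeratorKernel₃₊ (suc (suc j))
  step j h₀ h₁ =
    ≗-trans (unfold X U Q (walkNumerator (4 + j)) (walkNumerator (3 + j)))
    (≗-trans (+-cong (*-cong ≗-refl h₁) (*-cong ≗-refl h₀))
      (fold X U (walkNumerator (1 + j)) (walkNumerator (2 + j)) (walkNumerator (3 + j))
                (walkNumerator (4 + j)) (walkNumerator (5 + j)) (walkNumerator (6 + j))))
    where
    unfold = solve 5 (λ x u q a b → q :* q :* (x :* a :+ x :* (u :* u) :* b)
                                    := x :* (q :* q :* a) :+ x :* (u :* u) :* (q :* q :* b)) ≗-refl
    fold = solve 8 (λ x u p₁ p₂ p₃ p₄ p₅ p₆ →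
      x :* (x :* (u :^ 4 :* p₂ :+ u :^ 3 :* p₃ :+ u :* p₅ :+ p₆))
        :+ x :* (u :* u) :* (x :* (u :^ 4 :* p₁ :+ u :^ 3 :* p₂ :+ u :* p₄ :+ p₅))
      := x :* (u :^ 4 :* (x :* p₂ :+ x :* (u :* u) :* p₁) :+ u :^ 3 :* (x :* p₃ :+ x :* (u :* u) :* p₂)
               :+ u :* (x :* p₅ :+ x :* (u :* u) :* p₄) :+ (x :* p₆ :+ x :* (u :* u) :* p₅))) ≗-refl
  consecutive : ∀ j → NumeratorKernel₃₊ j × NumeratorKernel₃₊ (suc j)
  consecutive zero = solve 1 (equationₑ 0) ≗-refl X , solve 1 (equationₑ 1) ≗-refl X
  consecutive (suc j) with consecutive j
  ... | h₀ , h₁ = h₁ , step j h₀ h₁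

geometric*U≗1ₛ : geometric *ₛ U ≗ 1ₛ
geometric*U≗1ₛ =
  ≗-trans (expand geometric X) (≗-trans (+-cong geometric-unfold ≗-refl) (collapse geometric X))
  where
  expand = solve 2 (λ g x → g :* (con (+ 1) :+ :- x) := g :+ :- (x :* g)) ≗-refl
  collapse = solve 2 (λ g x → con (+ 1) :+ x :* g :+ :- (x :* g) := con (+ 1)) ≗-refl

-- The ring solver does not know geometric · U = 1, so identities relying on it are
-- proved up to a multiple of geometric · U - 1.
≗-modulo-geometric*U : ∀ A B Z → A ≗ B +ₛ (geometric *ₛ U +ₛ -ₛ 1ₛ) *ₛ Z → A ≗ B
≗-modulo-geometric*U A B Z h =
  ≗-trans h (≗-trans (+-congˡ B (≗-trans (*-congʳ Z vanishes) (*-zeroˡ Z))) (λ n → ℤₚ.+-identityʳ (B n)))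
  where
  vanishes : geometric *ₛ U +ₛ -ₛ 1ₛ ≗ 0ₛ
  vanishes n = trans (cong (_+ℤ - 1ₛ n) (geometric*U≗1ₛ n)) (ℤₚ.+-inverseʳ (1ₛ n))

ψ≗1+X²geometric : ψ ≗ 1ₛ +ₛ X *ₛ X *ₛ geometric
ψ≗1+X²geometric =
  ≗-trans (+-congʳ (-ₛ X) (≗-trans geometric-unfold (+-congˡ 1ₛ (*-congˡ X geometric-unfold))))
          (solve 2 (λ g x → con (+ 1) :+ x :* (con (+ 1) :+ x :* g) :+ :- x := con (+ 1) :+ x :* x :* g)
                   ≗-refl geometric X)

ψ≗Q*geometric : ψ ≗ Q *ₛ geometric
ψ≗Q*geometric =
  ≗-trans ψ≗1+X²geometric
          (≗-sym (≗-trans (expand U X geometric) (+-congʳ (X *ₛ X *ₛ geometric) geometric*U≗1ₛ)))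
  where
  expand = solve 3 (λ u x g → (u :+ x :* x) :* g := g :* u :+ x :* x :* g) ≗-refl

Λ≗Q²geometric² : Λ ≗ Q *ₛ Q *ₛ (geometric *ₛ geometric)
Λ≗Q²geometric² =
  ≗-trans (*-cong ψ≗Q*geometric ψ≗Q*geometric)
          (solve 2 (λ q g → (q :* g) :* (q :* g) := q :* q :* (g :* g)) ≗-refl Q geometric)

walkKernel₁ : Λ *ₛ walkSeries 1 ≗ X *ₛ (walkSeries 2 +ₛ walkSeries 3)
walkKernel₁ =
  ≗-trans (*-congʳ (walkSeries 1) Λ≗Q²geometric²)
  (≗-trans (gather Q geometric (walkNumerator 1))
  (≗-trans (*-congˡ (geometric ^ₛ 5) numeratorKernel₁)
  (≗-modulo-geometric*U _ _ _ (distribute geometric U X (walkNumerator 2) (walkNumerator 3)))))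
  where
  gather = solve 3 (λ q g p → q :* q :* (g :* g) :* (g :^ 3 :* p) := g :^ 5 :* (q :* q :* p)) ≗-refl
  distribute = solve 5 (λ g u x p₂ p₃ →
    g :^ 5 :* (x :* (u :* p₂ :+ p₃))
      := x :* (g :^ 4 :* p₂ :+ g :^ 5 :* p₃) :+ (g :* u :+ :- con (+ 1)) :* (x :* g :^ 4 :* p₂)) ≗-refl

walkKernel₂ : Λ *ₛ walkSeries 2 ≗ + 1 · Λ +ₛ X *ₛ (walkSeries 1 +ₛ walkSeries 3 +ₛ walkSeries 4)
walkKernel₂ =
  ≗-trans (*-congʳ (walkSeries 2) Λ≗Q²geometric²)
  (≗-trans (gather Q geometric (walkNumerator 2))
  (≗-trans (*-congˡ (geometric ^ₛ 6) numeratorKernel₂)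
  (≗-trans (≗-modulo-geometric*U _ _ _ (distribute geometric U X Q (walkNumerator 1) (walkNumerator 3) (walkNumerator 4)))
  (+-congʳ _ (λ n → trans (sym (Λ≗Q²geometric² n)) (sym (ℤₚ.*-identityˡ (Λ n))))))))
  where
  gather = solve 3 (λ q g p → q :* q :* (g :* g) :* (g :^ 4 :* p) := g :^ 6 :* (q :* q :* p)) ≗-refl
  distribute = solve 7 (λ g u x q p₁ p₃ p₄ →
    g :^ 6 :* (q :* q :* u :^ 4 :+ x :* (u :^ 3 :* p₁ :+ u :* p₃ :+ p₄))
      := q :* q :* (g :* g) :+ x :* (g :^ 3 :* p₁ :+ g :^ 5 :* p₃ :+ g :^ 6 :* p₄)
         :+ (g :* u :+ :- con (+ 1))
            :* (q :* q :* (g :* g) :* ((g :* u) :^ 3 :+ (g :* u) :^ 2 :+ g :* u :+ con (+ 1))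
                :+ x :* (g :^ 3 :* ((g :* u) :^ 2 :+ g :* u :+ con (+ 1)) :* p₁ :+ g :^ 5 :* p₃))) ≗-refl

walkKernel₃₊ : ∀ k → Λ *ₛ walkSeries (3 + k) ≗
  X *ₛ (walkSeries (1 + k) +ₛ walkSeries (2 + k) +ₛ walkSeries (4 + k) +ₛ walkSeries (5 + k))
walkKernel₃₊ k =
  ≗-trans (*-congʳ (walkSeries (3 + k)) Λ≗Q²geometric²)
  (≗-trans (gather Q geometric a (walkNumerator (3 + k)))
  (≗-trans (*-congˡ (geometric ^ₛ 4 *ₛ a) (numeratorKernel₃₊ k))
  (≗-modulo-geometric*U _ _ _
     (distribute geometric U X a (walkNumerator (1 + k)) (walkNumerator (2 + k))
                 (walkNumerator (4 + k)) (walkNumerator (5 + k))))))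
  where
  a = geometric ^ₛ (3 + k)
  gather = solve 4 (λ q g a p → q :* q :* (g :* g) :* (g :* (g :* a) :* p) := g :^ 4 :* a :* (q :* q :* p)) ≗-refl
  distribute = solve 8 (λ g u x a p₁ p₂ p₄ p₅ →
    g :^ 4 :* a :* (x :* (u :^ 4 :* p₁ :+ u :^ 3 :* p₂ :+ u :* p₄ :+ p₅))
      := x :* (a :* p₁ :+ g :* a :* p₂ :+ g :* (g :* (g :* a)) :* p₄ :+ g :* (g :* (g :* (g :* a))) :* p₅)
         :+ (g :* u :+ :- con (+ 1))
            :* (x :* a :* (((g :* u) :^ 3 :+ (g :* u) :^ 2 :+ g :* u :+ con (+ 1)) :* p₁
                :+ g :* ((g :* u) :^ 2 :+ g :* u :+ con (+ 1)) :* p₂ :+ g :^ 3 :* p₄))) ≗-refl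

walksFrom≡rootCoeff : ∀ n k → + walksFrom n (+ suc k) ≡ rootCoeff n (walkSeries (suc k))
walksFrom≡rootCoeff zero zero = refl
walksFrom≡rootCoeff zero (suc zero) = refl
walksFrom≡rootCoeff zero (suc (suc j)) = sym (ℤₚ.*-zeroʳ ((geometric ^ₛ (5 + j)) 0))
walksFrom≡rootCoeff (suc n) zero =
  begin
    + walksFrom (suc n) (+ 1)
  ≡⟨ cong +_ (trans (walksFrom-suc n (+ 1)) (cong (_+_ (walksFrom n (+ 2))) (ℕₚ.+-identityʳ _))) ⟩
    + walksFrom n (+ 2) +ℤ + walksFrom n (+ 3)
  ≡⟨ cong₂ _+ℤ_ (walksFrom≡rootCoeff n 1) (walksFrom≡rootCoeff n 2) ⟩
    rootCoeff n (walkSeries 2) +ℤ rootCoeff n (walkSeries 3)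
  ≡⟨ sym (rootCoeff-+ n (walkSeries 2) (walkSeries 3)) ⟩
    rootCoeff n (walkSeries 2 +ₛ walkSeries 3)
  ≡⟨ sym (rootCoeff-step₀ (walkSeries 1) _ walkKernel₁ n) ⟩
    rootCoeff (suc n) (walkSeries 1)
  ∎
  where open ≡-Reasoning
walksFrom≡rootCoeff (suc n) (suc zero) =
  begin
    + walksFrom (suc n) (+ 2)
  ≡⟨ cong +_ (trans (walksFrom-suc n (+ 2)) (reassociate (W 1) (W 3) (W 4))) ⟩
    + walksFrom n (+ 1) +ℤ + walksFrom n (+ 3) +ℤ + walksFrom n (+ 4)
  ≡⟨ cong₂ _+ℤ_ (cong₂ _+ℤ_ (walksFrom≡rootCoeff n 0) (walksFrom≡rootCoeff n 2)) (walksFrom≡rootCoeff n 3) ⟩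
    rootCoeff n (walkSeries 1) +ℤ rootCoeff n (walkSeries 3) +ℤ rootCoeff n (walkSeries 4)
  ≡⟨ sym (trans (rootCoeff-+ n _ (walkSeries 4)) (cong (_+ℤ R 4) (rootCoeff-+ n (walkSeries 1) (walkSeries 3)))) ⟩
    rootCoeff n (walkSeries 1 +ₛ walkSeries 3 +ₛ walkSeries 4)
  ≡⟨ sym (rootCoeff-step (+ 1) (walkSeries 2) _ walkKernel₂ n) ⟩
    rootCoeff (suc n) (walkSeries 2)
  ∎
  where
  open ≡-Reasoning
  W = λ h → walksFrom n (+ h)
  R = λ h → rootCoeff n (walkSeries h)
  reassociate : ∀ a b c → a + (b + (c + 0)) ≡ a + b + c
  reassociate = solveℕ-∀
walksFrom≡rootCoeff (suc n) (suc (suc j)) =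
  begin
    + walksFrom (suc n) (+ (3 + j))
  ≡⟨ cong +_ (trans (walksFrom-suc n (+ (3 + j))) neighbours) ⟩
    + W (1 + j) +ℤ + W (2 + j) +ℤ + W (4 + j) +ℤ + W (5 + j)
  ≡⟨ cong₂ _+ℤ_ (cong₂ _+ℤ_ (cong₂ _+ℤ_ (walksFrom≡rootCoeff n j) (walksFrom≡rootCoeff n (1 + j)))
                          (walksFrom≡rootCoeff n (3 + j)))
                (walksFrom≡rootCoeff n (4 + j)) ⟩
    R (1 + j) +ℤ R (2 + j) +ℤ R (4 + j) +ℤ R (5 + j)
  ≡⟨ sym (trans (rootCoeff-+ n _ (walkSeries (5 + j)))
                (cong (_+ℤ R (5 + j)) (trans (rootCoeff-+ n _ (walkSeries (4 + j)))
                                     (cong (_+ℤ R (4 + j)) (rootCoeff-+ n (walkSeries (1 + j)) (walkSeries (2 + j))))))) ⟩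
    rootCoeff n (walkSeries (1 + j) +ₛ walkSeries (2 + j) +ₛ walkSeries (4 + j) +ₛ walkSeries (5 + j))
  ≡⟨ sym (rootCoeff-step₀ (walkSeries (3 + j)) _ (walkKernel₃₊ j) n) ⟩
    rootCoeff (suc n) (walkSeries (3 + j))
  ∎
  where
  open ≡-Reasoning
  W = λ h → walksFrom n (+ h)
  R = λ h → rootCoeff n (walkSeries h)
  reassociate : ∀ a b c d → a + (b + (c + (d + 0))) ≡ a + b + c + d
  reassociate = solveℕ-∀
  neighbours : walksFrom n (+ (1 + j)) + (walksFrom n (+ (2 + j)) + (walksFrom n (+ (3 + (j + 1)))
                 + (walksFrom n (+ (3 + (j + 2))) + 0))) ≡ W (1 + j) + W (2 + j) + W (4 + j) + W (5 + j)
  neighbours = trans (reassociate (W (1 + j)) (W (2 + j)) (W (3 + (j + 1))) (W (3 + (j + 2))))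
    (cong₂ (λ a b → W (1 + j) + W (2 + j) + W (3 + a) + W (3 + b)) (ℕₚ.+-comm j 1) (ℕₚ.+-comm j 2))

numWalks-suc : ∀ n → + numWalks (suc n) ≡ rootCoeff n (walkSeries 1 +ₛ walkSeries 2)
numWalks-suc n =
  begin
    + numWalks (suc n)
  ≡⟨ cong +_ (trans (walksFrom-suc n (+ 0)) (cong (_+_ (walksFrom n (+ 1))) (ℕₚ.+-identityʳ _))) ⟩
    + walksFrom n (+ 1) +ℤ + walksFrom n (+ 2)
  ≡⟨ cong₂ _+ℤ_ (walksFrom≡rootCoeff n 0) (walksFrom≡rootCoeff n 1) ⟩
    rootCoeff n (walkSeries 1) +ℤ rootCoeff n (walkSeries 2)
  ≡⟨ sym (rootCoeff-+ n (walkSeries 1) (walkSeries 2)) ⟩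
    rootCoeff n (walkSeries 1 +ₛ walkSeries 2)
  ∎
  where open ≡-Reasoning

Q⁻¹ : Series
Q⁻¹ zero = + 1
Q⁻¹ (suc zero) = + 1
Q⁻¹ (suc (suc n)) = Q⁻¹ (suc n) +ℤ - Q⁻¹ n

Q*Q⁻¹≗1ₛ : Q *ₛ Q⁻¹ ≗ 1ₛ
Q*Q⁻¹≗1ₛ = ≗-trans (expand X Q⁻¹) coefficients
  where
  expand = solve 2 (λ x k → (con (+ 1) :+ :- x :+ x :* x) :* k := k :+ :- (x :* k) :+ x :* (x :* k)) ≗-refl
  coefficients : Q⁻¹ +ₛ -ₛ (X *ₛ Q⁻¹) +ₛ X *ₛ (X *ₛ Q⁻¹) ≗ 1ₛ
  coefficients zero = refl
  coefficients (suc zero) = refl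
  coefficients (suc (suc n)) =
    trans (cong₂ (λ a b → Q⁻¹ (2 + n) +ℤ - a +ℤ b) (X*≗shift Q⁻¹ (2 + n))
                 (trans (X*≗shift (X *ₛ Q⁻¹) (2 + n)) (X*≗shift Q⁻¹ (1 + n))))
          (cancel (Q⁻¹ (1 + n)) (Q⁻¹ n))
    where
    cancel : ∀ a b → a +ℤ - b +ℤ - a +ℤ b ≡ + 0
    cancel = solve-∀

G : Series
G = X *ₛ X *ₛ Q⁻¹

G*ψ≗ψ-1 : G *ₛ ψ ≗ ψ +ₛ -ₛ 1ₛ
G*ψ≗ψ-1 =
  ≗-trans (*-congˡ G ψ≗Q*geometric)
  (≗-trans (swap X Q⁻¹ Q geometric)
  (≗-trans (*-congˡ (X *ₛ X *ₛ geometric) Q*Q⁻¹≗1ₛ)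
  (≗-trans (*-identityʳ _) (≗-sym (≗-trans (+-congʳ (-ₛ 1ₛ) ψ≗1+X²geometric) (cancel X geometric))))))
  where
  swap = solve 4 (λ x k q g → x :* x :* k :* (q :* g) := x :* x :* g :* (q :* k)) ≗-refl
  cancel = solve 2 (λ x g → con (+ 1) :+ x :* x :* g :+ :- con (+ 1) := x :* x :* g) ≗-refl

∂G*Λ≗∂ψ : ∂ G *ₛ Λ ≗ ∂ ψ
∂G*Λ≗∂ψ =
  ≗-trans (expand (∂ G) G ψ (∂ ψ))
  (≗-trans (+-cong (*-congˡ ψ leibniz) (-‿cong (*-congˡ (∂ ψ) G*ψ≗ψ-1)))
  (cancel ψ (∂ ψ)))
  where
  leibniz : ∂ G *ₛ ψ +ₛ G *ₛ ∂ ψ ≗ ∂ ψ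
  leibniz = ≗-trans (≗-sym (∂-* G ψ))
                    (≗-trans (∂-cong G*ψ≗ψ-1) (λ n → cong (+ suc n *ℤ_) (ℤₚ.+-identityʳ _)))
  expand = solve 4 (λ dg g p dp → dg :* (p :* p) := p :* (dg :* p :+ g :* dp) :+ :- (dp :* (g :* p))) ≗-refl
  cancel = solve 2 (λ p dp → p :* dp :+ :- (dp :* (p :+ :- con (+ 1))) := dp) ≗-refl

walkSeries₁+walkSeries₂≗Q³geometric⁴ : walkSeries 1 +ₛ walkSeries 2 ≗ Q ^ₛ 3 *ₛ geometric ^ₛ 4
walkSeries₁+walkSeries₂≗Q³geometric⁴ = ≗-modulo-geometric*U _ _ _ (identity geometric U X Q)
  where
  identity = solve 4 (λ g u x q → g :^ 3 :* (x :* (q :* q)) :+ g :^ 4 :* (q :* q :* (q :+ :- (x :* u)))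
    := q :^ 3 :* g :^ 4 :+ (g :* u :+ :- con (+ 1)) :* (:- (g :^ 3 :* x :* (q :* q)))) ≗-refl

Λ*[Λ*Q⁻¹]≗walkSeries₁+walkSeries₂ : Λ *ₛ (Λ *ₛ Q⁻¹) ≗ walkSeries 1 +ₛ walkSeries 2
Λ*[Λ*Q⁻¹]≗walkSeries₁+walkSeries₂ =
  ≗-trans (*-cong Λ≗Q²geometric² (*-congʳ Q⁻¹ Λ≗Q²geometric²))
  (≗-trans (gather Q geometric Q⁻¹)
  (≗-trans (*-congˡ (Q ^ₛ 3 *ₛ geometric ^ₛ 4) Q*Q⁻¹≗1ₛ)
  (≗-trans (*-identityʳ _) (≗-sym walkSeries₁+walkSeries₂≗Q³geometric⁴))))
  where
  gather = solve 3 (λ q g k → q :* q :* (g :* g) :* (q :* q :* (g :* g) :* k) := q :^ 3 :* g :^ 4 :* (q :* k)) ≗-refl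

rootCoeff-G : ∀ n → rootCoeff (suc n) G ≡ + numWalks n
rootCoeff-G zero = refl
rootCoeff-G (suc m) =
  begin
    rootCoeff (suc (suc m)) G
  ≡⟨ rootCoeff-step₀ G _ ΛG≗X[XΛQ⁻¹] (suc m) ⟩
    rootCoeff (suc m) (X *ₛ (Λ *ₛ Q⁻¹))
  ≡⟨ rootCoeff-step₀ _ _ (shuffle Λ X (Λ *ₛ Q⁻¹)) m ⟩
    rootCoeff m (Λ *ₛ (Λ *ₛ Q⁻¹))
  ≡⟨ rootCoeff-cong m Λ*[Λ*Q⁻¹]≗walkSeries₁+walkSeries₂ ⟩
    rootCoeff m (walkSeries 1 +ₛ walkSeries 2)
  ≡⟨ sym (numWalks-suc m) ⟩
    + numWalks (suc m)
  ∎
  where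
  open ≡-Reasoning
  shuffle = solve 3 (λ l x f → l :* (x :* f) := x :* (l :* f)) ≗-refl
  ΛG≗X[XΛQ⁻¹] : Λ *ₛ G ≗ X *ₛ (X *ₛ (Λ *ₛ Q⁻¹))
  ΛG≗X[XΛQ⁻¹] = solve 3 (λ l x k → l :* (x :* x :* k) := x :* (x :* (l :* k))) ≗-refl Λ X Q⁻¹

Λ^≗ψ^ : ∀ k → Λ ^ₛ k ≗ ψ ^ₛ (k + k)
Λ^≗ψ^ k = ≗-trans (^-distrib-* ψ ψ k) (≗-sym (^-homo-* ψ k k))

-- By the derivative form of Lagrange inversion, since G = 1 - 1/ψ and Λ = ψ².
ψ^-coefficient : ∀ n → (ψ ^ₛ suc (n + n)) (suc n) ≡ + suc (n + n) *ℤ rootCoeff (suc n) G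
ψ^-coefficient n = ℤₚ.*-cancelˡ-≡ (+ suc n) _ _
  (begin
    + suc n *ℤ (ψ ^ₛ suc (n + n)) (suc n)
  ≡⟨ ∂-^ ψ (n + n) n ⟩
    + suc (n + n) *ℤ (ψ ^ₛ (n + n) *ₛ ∂ ψ) n
  ≡⟨ cong (+ suc (n + n) *ℤ_) (sym (∂G*Λ^ n)) ⟩
    + suc (n + n) *ℤ (∂ G *ₛ Λ ^ₛ suc n) n
  ≡⟨ cong (+ suc (n + n) *ℤ_) (sym (rootCoeff-∂ n G)) ⟩
    + suc (n + n) *ℤ (+ suc n *ℤ rootCoeff (suc n) G)
  ≡⟨ swap (+ suc (n + n)) (+ suc n) (rootCoeff (suc n) G) ⟩
    + suc n *ℤ (+ suc (n + n) *ℤ rootCoeff (suc n) G)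
  ∎)
  where
  open ≡-Reasoning
  ∂G*Λ^ : ∂ G *ₛ Λ ^ₛ suc n ≗ ψ ^ₛ (n + n) *ₛ ∂ ψ
  ∂G*Λ^ = ≗-trans (≗-sym (*-assoc (∂ G) Λ (Λ ^ₛ n)))
                  (≗-trans (*-cong ∂G*Λ≗∂ψ (Λ^≗ψ^ n)) (*-comm (∂ ψ) (ψ ^ₛ (n + n))))
  swap : ∀ a b c → a *ℤ (b *ℤ c) ≡ b *ℤ (a *ℤ c)
  swap = solve-∀

-- Expanding the powers of ψ

P′-vanishes : ∀ {a b} → a < b → a P′ b ≡ 0
P′-vanishes {a} {suc b} (s≤s a≤b) with ℕₚ.m≤n⇒m<n∨m≡n a≤b
... | inj₁ a<b = trans (cong ((a ∸ b) *_) (P′-vanishes a<b)) (ℕₚ.*-zeroʳ (a ∸ b))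
... | inj₂ refl = cong (_* (a P′ a)) (ℕₚ.n∸n≡0 a)

fallingℤ≡P′ : ∀ a b → fallingℤ (+ a) b ≡ + (a P′ b)
fallingℤ≡P′ a zero = refl
fallingℤ≡P′ a (suc b) with ℕₚ.≤-<-connex b a
... | inj₁ b≤a =
  begin
    fallingℤ (+ a) b *ℤ (+ a +ℤ - + b)
  ≡⟨ cong₂ _*ℤ_ (fallingℤ≡P′ a b) (trans (ℤₚ.m-n≡m⊖n a b) (ℤₚ.⊖-≥ b≤a)) ⟩
    + (a P′ b) *ℤ + (a ∸ b)
  ≡⟨ sym (ℤₚ.pos-* (a P′ b) (a ∸ b)) ⟩
    + ((a P′ b) * (a ∸ b))
  ≡⟨ cong +_ (ℕₚ.*-comm (a P′ b) (a ∸ b)) ⟩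
    + (a P′ suc b)
  ∎
  where open ≡-Reasoning
... | inj₂ a<b rewrite fallingℤ≡P′ a b | P′-vanishes a<b | ℕₚ.m≤n⇒m∸n≡0 (ℕₚ.<⇒≤ a<b) = refl

binomℤ-+ : ∀ a b → binomℤ (+ a) b ≡ + (a C b)
binomℤ-+ a b =
  trans (cong (λ z → + 1 *ℤ (z /ℕ b !)) (fallingℤ≡P′ a b))
        (trans (ℤₚ.*-identityˡ _) (cong +_ (P′/!≡C (ℕₚ.≤-<-connex b a))))
  where
  instance _ = b ℕₚ.!≢0
  P′/!≡C : b ≤ a ⊎ a < b → (a P′ b) / b ! ≡ a C b
  P′/!≡C (inj₁ b≤a) = sym (trans (nCk≡nPk/k! b≤a) (cong (_/ b !) (P≡P′ b≤a)))
    where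
    P≡P′ : b ≤ a → a P b ≡ a P′ b
    P≡P′ b≤a with b ℕ.≤ᵇ a | ℕₚ.≤⇒≤ᵇ b≤a
    ... | true | _ = refl
  P′/!≡C (inj₂ a<b) = trans (cong (_/ b !) (P′-vanishes a<b)) (trans (0/n≡0 (b !)) (sym (k>n⇒nCk≡0 a<b)))

geometric^-coefficient : ∀ j i → (geometric ^ₛ suc j) i ≡ + ((i + j) C i)
geometric^-coefficient zero i =
  trans (*-identityʳ geometric i) (cong +_ (sym (trans (cong (_C i) (ℕₚ.+-identityʳ i)) (nCn≡1 i))))
geometric^-coefficient (suc j) zero = lemma (2 + j)
  where
  lemma : ∀ k → (geometric ^ₛ k) 0 ≡ + 1
  lemma zero = refl
  lemma (suc k) = trans (ℤₚ.*-identityˡ _) (lemma k)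
geometric^-coefficient (suc j) (suc i) =
  begin
    (geometric ^ₛ suc (suc j)) (suc i)
  ≡⟨ unfold (suc i) ⟩
    (geometric ^ₛ suc j) (suc i) +ℤ (X *ₛ geometric ^ₛ suc (suc j)) (suc i)
  ≡⟨ cong₂ _+ℤ_ (geometric^-coefficient j (suc i))
                (trans (X*≗shift _ (suc i)) (geometric^-coefficient (suc j) i)) ⟩
    + (suc (i + j) C suc i) +ℤ + ((i + suc j) C i)
  ≡⟨ cong (λ t → + (suc (i + j) C suc i) +ℤ + (t C i)) (ℕₚ.+-suc i j) ⟩
    + (suc (i + j) C suc i + suc (i + j) C i)
  ≡⟨ cong +_ (trans (ℕₚ.+-comm (suc (i + j) C suc i) _) (nCk+nC[k+1]≡[n+1]C[k+1] (suc (i + j)) i)) ⟩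
    + (suc (suc (i + j)) C suc i)
  ≡⟨ cong (λ t → + (suc t C suc i)) (sym (ℕₚ.+-suc i j)) ⟩
    + ((suc i + suc j) C suc i)
  ∎
  where
  open ≡-Reasoning
  unfold : geometric ^ₛ suc (suc j) ≗ geometric ^ₛ suc j +ₛ X *ₛ geometric ^ₛ suc (suc j)
  unfold = ≗-trans (*-congʳ (geometric ^ₛ suc j) geometric-unfold)
                   (solve 3 (λ x g p → (con (+ 1) :+ x :* g) :* p := p :+ x :* (g :* p))
                          ≗-refl X geometric (geometric ^ₛ suc j))

geometric^≡binomℤ : ∀ j i → (geometric ^ₛ j) i ≡ binomℤ (+ (i + j) +ℤ - + 1) i
geometric^≡binomℤ zero zero = refl
geometric^≡binomℤ zero (suc i) rewrite ℕₚ.+-identityʳ i =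
  sym (trans (binomℤ-+ i (suc i)) (cong +_ (k>n⇒nCk≡0 (ℕₚ.n<1+n i))))
geometric^≡binomℤ (suc j) i rewrite ℕₚ.+-suc i j =
  trans (geometric^-coefficient j i) (sym (binomℤ-+ (i + j) i))

sign-suc : ∀ m → sign (suc m) ≡ - sign m
sign-suc zero = refl
sign-suc (suc zero) = refl
sign-suc (suc (suc m)) = sign-suc m

sign-+-even : ∀ k e → sign (k + k + e) ≡ sign e
sign-+-even zero e = refl
sign-+-even (suc k) e = trans (cong (λ z → sign (suc z + e)) (ℕₚ.+-suc k k)) (sign-+-even k e)

shiftBy : ℕ → Series → Series
shiftBy zero F = F
shiftBy (suc e) F = shift (shiftBy e F)

shiftBy-+ : ∀ e F j → shiftBy e F (e + j) ≡ F j
shiftBy-+ zero F j = refl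
shiftBy-+ (suc e) F j = shiftBy-+ e F j

shiftBy-< : ∀ e F {j} → j < e → shiftBy e F j ≡ + 0
shiftBy-< (suc e) F {zero} _ = refl
shiftBy-< (suc e) F {suc j} (s≤s j<e) = shiftBy-< e F j<e

*-[-X]^ : ∀ e F → F *ₛ (-ₛ X) ^ₛ e ≗ sign e · shiftBy e F
*-[-X]^ zero F n = trans (*-identityʳ F n) (sym (ℤₚ.*-identityˡ (F n)))
*-[-X]^ (suc e) F n =
  begin
    (F *ₛ ((-ₛ X) *ₛ (-ₛ X) ^ₛ e)) n
  ≡⟨ rearrange F X ((-ₛ X) ^ₛ e) n ⟩
    - (X *ₛ (F *ₛ (-ₛ X) ^ₛ e)) n
  ≡⟨ cong -_ (trans (*-congˡ X (*-[-X]^ e F) n) (trans (*-·-comm (sign e) X (shiftBy e F) n)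
                                                       (cong (sign e *ℤ_) (X*≗shift (shiftBy e F) n)))) ⟩
    - (sign e *ℤ shiftBy (suc e) F n)
  ≡⟨ trans (ℤₚ.neg-distribˡ-* (sign e) _) (cong (_*ℤ shiftBy (suc e) F n) (sym (sign-suc e))) ⟩
    sign (suc e) *ℤ shiftBy (suc e) F n
  ∎
  where
  open ≡-Reasoning
  rearrange = solve 3 (λ f x p → f :* (:- x :* p) := :- (x :* (f :* p))) ≗-refl

sumBelow : ℕ → (ℕ → ℤ) → ℤ
sumBelow zero f = + 0
sumBelow (suc n) f = f 0 +ℤ sumBelow n (f ∘ suc)

sumℤ-map-applyUpTo : ∀ (f : ℕ → ℤ) g n → sumℤ (map f (applyUpTo g n)) ≡ sumBelow n (f ∘ g)
sumℤ-map-applyUpTo f g zero = refl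
sumℤ-map-applyUpTo f g (suc n) = cong (f (g 0) +ℤ_) (sumℤ-map-applyUpTo f (g ∘ suc) n)

sumBelow-+ : ∀ f a b → sumBelow (a + b) f ≡ sumBelow a f +ℤ sumBelow b (λ k → f (a + k))
sumBelow-+ f zero b = sym (ℤₚ.+-identityˡ _)
sumBelow-+ f (suc a) b = trans (cong (f 0 +ℤ_) (sumBelow-+ (f ∘ suc) a b)) (sym (ℤₚ.+-assoc (f 0) _ _))

sumBelow-cong : ∀ {f g} n → (∀ k → k < n → f k ≡ g k) → sumBelow n f ≡ sumBelow n g
sumBelow-cong zero eq = refl
sumBelow-cong (suc n) eq = cong₂ _+ℤ_ (eq 0 (s≤s z≤n)) (sumBelow-cong n (λ k k<n → eq (suc k) (s≤s k<n)))

sumBelow-zero : ∀ {f} n → (∀ k → k < n → f k ≡ + 0) → sumBelow n f ≡ + 0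
sumBelow-zero zero eq = refl
sumBelow-zero (suc n) eq = cong₂ _+ℤ_ (eq 0 (s≤s z≤n)) (sumBelow-zero n (λ k k<n → eq (suc k) (s≤s k<n)))

sum-coefficient : ∀ m (w : ℕ → Series) i → sum {m} (λ k → w (toℕ k)) i ≡ sumBelow m (λ j → w j i)
sum-coefficient zero w i = refl
sum-coefficient (suc m) w i = cong (w 0 i +ℤ_) (sum-coefficient m (w ∘ suc) i)

×-coefficient : ∀ c F i → (c ×ₛ F) i ≡ + c *ℤ F i
×-coefficient zero F i = refl
×-coefficient (suc c) F i = trans (cong (F i +ℤ_) (×-coefficient c F i)) (sym (ℤₚ.suc-* (+ c) (F i)))

open import Algebra.Properties.Semiring.Binomial seriesSemiring geometric (-ₛ X)
  using () renaming (theorem to binomialTheorem)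

binomialTerm : ℕ → ℕ → Series
binomialTerm N j = (N C j) ×ₛ (geometric ^ₛ j *ₛ (-ₛ X) ^ₛ (N ∸ j))

binomialTerm-coefficient : ∀ N j i →
  binomialTerm N j i ≡ + (N C j) *ℤ (sign (N ∸ j) *ℤ shiftBy (N ∸ j) (geometric ^ₛ j) i)
binomialTerm-coefficient N j i =
  trans (×-coefficient (N C j) _ i) (cong (+ (N C j) *ℤ_) (*-[-X]^ (N ∸ j) (geometric ^ₛ j) i))

2n+1≡n+suc-n : ∀ n → 2 * n + 1 ≡ n + suc n
2n+1≡n+suc-n = solveℕ-∀

binomialTerm-vanishes : ∀ n j → j < n → binomialTerm (2 * n + 1) j (suc n) ≡ + 0
binomialTerm-vanishes n j j<n =
  trans (binomialTerm-coefficient N j (suc n))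
        (trans (cong (λ z → + (N C j) *ℤ (sign (N ∸ j) *ℤ z)) (shiftBy-< (N ∸ j) _ n+1<N∸j))
               (trans (cong (+ (N C j) *ℤ_) (ℤₚ.*-zeroʳ (sign (N ∸ j)))) (ℤₚ.*-zeroʳ (+ (N C j)))))
  where
  N = 2 * n + 1
  reorder : ∀ n j → suc j + suc n ≡ 2 + n + j
  reorder = solveℕ-∀
  n+1<N∸j : suc n < N ∸ j
  n+1<N∸j = ℕₚ.m+n≤o⇒m≤o∸n (2 + n)
              (subst₂ _≤_ (reorder n j) (sym (2n+1≡n+suc-n n)) (ℕₚ.+-monoˡ-≤ (suc n) j<n))

rhsTerm : ℕ → ℕ → ℤ
rhsTerm n k = sign (n + k + 1) *ℤ binomℤ (+ (2 * n + 1)) (n + k) *ℤ binomℤ (+ (n + 2 * k) +ℤ - + 1) k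

binomialTerm≡rhsTerm : ∀ n k → k ≤ suc n → binomialTerm (2 * n + 1) (n + k) (suc n) ≡ rhsTerm n k
binomialTerm≡rhsTerm n k k≤1+n =
  begin
    binomialTerm N (n + k) (suc n)
  ≡⟨ binomialTerm-coefficient N (n + k) (suc n) ⟩
    c *ℤ (sign e *ℤ shiftBy e (geometric ^ₛ (n + k)) (suc n))
  ≡⟨ cong (λ i → c *ℤ (sign e *ℤ shiftBy e (geometric ^ₛ (n + k)) i)) (sym e+k≡1+n) ⟩
    c *ℤ (sign e *ℤ shiftBy e (geometric ^ₛ (n + k)) (e + k))
  ≡⟨ cong (λ z → c *ℤ (sign e *ℤ z)) (trans (shiftBy-+ e _ k) (geometric^≡binomℤ (n + k) k)) ⟩
    c *ℤ (sign e *ℤ binomℤ (+ (k + (n + k)) +ℤ - + 1) k)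
  ≡⟨ cong₂ (λ s a → c *ℤ (s *ℤ binomℤ (+ a +ℤ - + 1) k)) sign-e (regroup n k) ⟩
    c *ℤ (sign (n + k + 1) *ℤ binomℤ (+ (n + 2 * k) +ℤ - + 1) k)
  ≡⟨ swap c (sign (n + k + 1)) _ ⟩
    sign (n + k + 1) *ℤ c *ℤ binomℤ (+ (n + 2 * k) +ℤ - + 1) k
  ≡⟨ cong (λ z → sign (n + k + 1) *ℤ z *ℤ binomℤ (+ (n + 2 * k) +ℤ - + 1) k) (sym (binomℤ-+ N (n + k))) ⟩
    rhsTerm n k
  ∎
  where
  open ≡-Reasoning
  N = 2 * n + 1
  c = + (N C (n + k))
  e = N ∸ (n + k)
  e+k≡1+n : e + k ≡ suc n
  e+k≡1+n = trans (cong (λ m → m ∸ (n + k) + k) (2n+1≡n+suc-n n))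
                  (trans (cong (_+ k) (ℕₚ.[m+n]∸[m+o]≡n∸o n (suc n) k)) (ℕₚ.m∸n+n≡m k≤1+n))
  regroup : ∀ n k → k + (n + k) ≡ n + 2 * k
  regroup = solveℕ-∀
  shuffle₁ : ∀ n k → n + k + 1 ≡ k + suc n
  shuffle₁ = solveℕ-∀
  shuffle₂ : ∀ k e → k + (e + k) ≡ k + k + e
  shuffle₂ = solveℕ-∀
  sign-e : sign e ≡ sign (n + k + 1)
  sign-e = sym (trans (cong sign (trans (shuffle₁ n k) (trans (cong (_+_ k) (sym e+k≡1+n)) (shuffle₂ k e))))
                      (sign-+-even k e))
  swap : ∀ c s b → c *ℤ (s *ℤ b) ≡ s *ℤ c *ℤ b
  swap = solve-∀

ψ^-coefficient≡rhsSum : ∀ n → (ψ ^ₛ (2 * n + 1)) (suc n) ≡ rhsSum n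
ψ^-coefficient≡rhsSum n =
  begin
    (ψ ^ₛ N) (suc n)
  ≡⟨ binomialTheorem (*-comm geometric (-ₛ X)) N (suc n) ⟩
    sum {suc N} (λ j → binomialTerm N (toℕ j)) (suc n)
  ≡⟨ sum-coefficient (suc N) (binomialTerm N) (suc n) ⟩
    sumBelow (suc N) T
  ≡⟨ cong (λ m → sumBelow m T) (1+N≡ n) ⟩
    sumBelow (n + (2 + n)) T
  ≡⟨ sumBelow-+ T n (2 + n) ⟩
    sumBelow n T +ℤ sumBelow (2 + n) (λ k → T (n + k))
  ≡⟨ cong₂ _+ℤ_ (sumBelow-zero n (binomialTerm-vanishes n))
                (sumBelow-cong (2 + n) (λ { k (s≤s k≤1+n) → binomialTerm≡rhsTerm n k k≤1+n })) ⟩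
    + 0 +ℤ sumBelow (2 + n) (rhsTerm n)
  ≡⟨ trans (ℤₚ.+-identityˡ _) (sym (sumℤ-map-applyUpTo (rhsTerm n) (λ k → k) (2 + n))) ⟩
    rhsSum n
  ∎
  where
  open ≡-Reasoning
  N = 2 * n + 1
  T = λ j → binomialTerm N j (suc n)
  1+N≡ : ∀ n → suc (2 * n + 1) ≡ n + (2 + n)
  1+N≡ = solveℕ-∀

mainTheorem9 : (n : ℕ) → (+ numWalks n) *ℤ (+ (2 * n + 1)) ≡ rhsSum n
mainTheorem9 n =
  begin
    + numWalks n *ℤ + (2 * n + 1)
  ≡⟨ ℤₚ.*-comm (+ numWalks n) (+ (2 * n + 1)) ⟩
    + (2 * n + 1) *ℤ + numWalks n
  ≡⟨ cong₂ _*ℤ_ (cong +_ (2n+1≡ n)) (sym (rootCoeff-G n)) ⟩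
    + suc (n + n) *ℤ rootCoeff (suc n) G
  ≡⟨ sym (ψ^-coefficient n) ⟩
    (ψ ^ₛ suc (n + n)) (suc n)
  ≡⟨ cong (λ N → (ψ ^ₛ N) (suc n)) (sym (2n+1≡ n)) ⟩
    (ψ ^ₛ (2 * n + 1)) (suc n)
  ≡⟨ ψ^-coefficient≡rhsSum n ⟩
    rhsSum n
  ∎
  where
  open ≡-Reasoning
  2n+1≡ : ∀ n → 2 * n + 1 ≡ suc (n + n)
  2n+1≡ = solveℕ-∀
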